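{- Let $p$ be an integer with $p\equiv 0\pmod 3$, let $k$ be a positive integer, and let $J=\{p+3i-2,\ p+3i-1 : i\in[1,k]\}$ and $J'=\{p+3i-1,\ p+3i+1 : i\in[1,k]\}$ (each a set of $2k$ integers). (i) If $k$ is odd, then $J$ can be partitioned into $k$ pairs whose pair sums are exactly the $k$ numbers $2p+\frac{3(k-1)}{2}+3i$, $i\in[1,k]$; and $J'$ can be partitioned into $k$ pairs whose pair sums are exactly the $k$ numbers $2p+\frac{3(k+1)}{2}+3i$, $i\in[1,k]$. (ii) If $k$ is even, then $J$ can be partitioned into $k$ pairs whose pair sums are exactly the $k-1$ numbers $2p+3(\frac{k}{2}+1)+3i$, $i\in[1,k-1]$, together with the number $2p+3$; and $J'$ can be partitioned into $k$ pairs whose pair sums are exactly the $k-1$ numbers $2p+3(\frac{k}{2}+2)+3i$, $i\in[1,k-1]$, together with the number $2p+6$.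
   Context: For integers $a\le b$, $[a,b]=\{a,a+1,\ldots,b\}$. -}

module Defs where

open import Data.Nat as ℕ using (ℕ; suc)
open import Data.Integer using (ℤ; +_; _+_; _-_; _*_)
open import Data.List using (List; []; _∷_; map; upTo; concatMap)
open import Data.Product using (Σ; _×_; _,_)
open import Data.List.Relation.Binary.Permutation.Propositional using (_↭_)

[1,_] : ℕ → List ℕ
[1, k ] = map suc (upTo k)

J : ℤ → ℕ → List ℤ
J p k = concatMap (λ i → (p + + 3 * + i - + 2) ∷ (p + + 3 * + i - + 1) ∷ []) [1, k ]

J′ : ℤ → ℕ → List ℤ
J′ p k = concatMap (λ i → (p + + 3 * + i - + 1) ∷ (p + + 3 * + i + + 1) ∷ []) [1, k ]

flatten : List (ℤ × ℤ) → List ℤ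
flatten [] = []
flatten ((a , b) ∷ ps) = a ∷ b ∷ flatten ps

pairSum : ℤ × ℤ → ℤ
pairSum (a , b) = a + b

-- S can be partitioned into pairs whose pair sums are exactly the list T
-- (as multisets; hence the number of pairs equals the length of T).
PairPartition : List ℤ → List ℤ → Set
PairPartition S T = Σ (List (ℤ × ℤ)) λ ps → (flatten ps ↭ S) × (map pairSum ps ↭ T)

-- J and J′ are each the union of two arithmetic progressions with difference 3.  Two
-- progressions x + di and y + di (0 ≤ i ≤ 2m) pair off in a staircase: x + di with
-- y + d(m+i) for i ≤ m, and x + d(m+1+i) with y + di for i < m.  The first group of sums
-- runs through the even-indexed terms, the second through the odd-indexed terms of the
-- progression x + y + dm + dj (0 ≤ j ≤ 2m).  This settles odd k; for even k the two
-- smallest elements form one pair and the staircase handles the remaining 2(k-1).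
module Submission where

open import Defs
open import Data.Nat as ℕ using (ℕ; zero; suc; _%_; _/_; _∸_)
open import Data.Nat.DivMod using (m*n/n≡m; m≡m%n+[m/n]*n)
open import Data.Nat.Properties using (+-suc; *-distribˡ-+)
import Data.Nat.Tactic.RingSolver as ℕ-Solver
open import Data.Integer using (ℤ; +_; _+_; _*_; _-_)
open import Data.Integer.Properties using (pos-*)
open import Data.Integer.Divisibility using (_∣_)
import Data.Integer.Tactic.RingSolver as ℤ-Solver
open import Data.List using (List; []; _∷_; _++_; map; concatMap; applyUpTo; upTo)
open import Data.List.Properties using (map-∘; map-upTo; map-++)
open import Data.List.Relation.Binary.Permutation.Propositional
  using (_↭_; prep; ↭-refl; ↭-sym; ↭-trans; ↭-reflexive; module PermutationReasoning)
open import Data.List.Relation.Binary.Permutation.Propositional.Properties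
  using (shift; ++⁺; ++⁺ˡ; ++-comm; ++-assoc)
open import Data.Product using (Σ; _×_; _,_)
open import Relation.Binary.PropositionalEquality
  using (_≡_; refl; sym; trans; cong; cong₂; subst)

flatten-++ : ∀ ps qs → flatten (ps ++ qs) ≡ flatten ps ++ flatten qs
flatten-++ []             qs = refl
flatten-++ ((a , b) ∷ ps) qs = cong (λ l → a ∷ b ∷ l) (flatten-++ ps qs)

pairPartition-↭ : ∀ {S S′ T T′} → PairPartition S T → S ↭ S′ → T ↭ T′ → PairPartition S′ T′
pairPartition-↭ (ps , flat , sums) S↭S′ T↭T′ = ps , ↭-trans flat S↭S′ , ↭-trans sums T↭T′

pairPartition-∷ : ∀ {S T} x y → PairPartition S T → PairPartition (x ∷ y ∷ S) (x + y ∷ T)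
pairPartition-∷ x y (ps , flat , sums) = (x , y) ∷ ps , prep x (prep y flat) , prep (x + y) sums

pairPartition-++ : ∀ {S S′ T T′} → PairPartition S T → PairPartition S′ T′ →
                   PairPartition (S ++ S′) (T ++ T′)
pairPartition-++ (ps , flat , sums) (ps′ , flat′ , sums′) =
  ps ++ ps′ ,
  ↭-trans (↭-reflexive (flatten-++ ps ps′)) (++⁺ flat flat′) ,
  ↭-trans (↭-reflexive (map-++ pairSum ps ps′)) (++⁺ sums sums′)

affine-suc : ∀ x d i → x + d * (+ 1 + i) ≡ (x + d) + d * i
affine-suc = ℤ-Solver.solve-∀

progression : ℤ → ℤ → ℕ → List ℤ
progression d x zero    = []
progression d x (suc n) = x ∷ progression d (x + d) n

progression-+ : ∀ d x m n →
                progression d x (m ℕ.+ n) ≡ progression d x m ++ progression d (x + d * + m) n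
progression-+ d x zero    n = cong (λ y → progression d y n) (x≡x+d*0 x d)
  where
  x≡x+d*0 : ∀ x d → x ≡ x + d * + 0
  x≡x+d*0 = ℤ-Solver.solve-∀
progression-+ d x (suc m) n =
  cong (x ∷_) (trans (progression-+ d (x + d) m n)
                     (cong (λ y → progression d (x + d) m ++ progression d y n) (sym (affine-suc x d (+ m)))))

applyUpTo-progression : ∀ d x n {f : ℕ → ℤ} → (∀ i → f i ≡ x + d * + i) →
                        applyUpTo f n ≡ progression d x n
applyUpTo-progression d x zero    f≗ = refl
applyUpTo-progression d x (suc n) f≗ =
  cong₂ _∷_ (trans (f≗ 0) (x+d*0≡x x d))
            (applyUpTo-progression d (x + d) n λ i → trans (f≗ (suc i)) (affine-suc x d (+ i)))
  where
  x+d*0≡x : ∀ x d → x + d * + 0 ≡ x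
  x+d*0≡x = ℤ-Solver.solve-∀

[1,]-progression : ∀ d x n {f : ℕ → ℤ} → (∀ i → f (suc i) ≡ x + d * + i) →
                   map f [1, n ] ≡ progression d x n
[1,]-progression d x n f≗ =
  trans (sym (map-∘ (upTo n))) (trans (map-upTo _ n) (applyUpTo-progression d x n f≗))

progression-as-[1,] : ∀ d a {x} n → x ≡ a + d → progression d x n ≡ map (λ i → a + d * + i) [1, n ]
progression-as-[1,] d a n refl = sym ([1,]-progression d (a + d) n λ i → affine-suc a d (+ i))

pairPartition-progressions-∷ : ∀ {T} d e x y n →
  PairPartition (progression d (x + d) n ++ progression e (y + e) n) T →
  PairPartition (progression d x (suc n) ++ progression e y (suc n)) (x + y ∷ T)
pairPartition-progressions-∷ d e x y n pp =
  pairPartition-↭ (pairPartition-∷ x y pp)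
    (prep x (↭-sym (shift y (progression d (x + d) n) (progression e (y + e) n)))) ↭-refl

pairPartition-progressions : ∀ d e x y n →
  PairPartition (progression d x n ++ progression e y n) (progression (d + e) (x + y) n)
pairPartition-progressions d e x y zero    = [] , ↭-refl , ↭-refl
pairPartition-progressions d e x y (suc n) =
  subst (λ z → PairPartition (progression d x (suc n) ++ progression e y (suc n))
                             (x + y ∷ progression (d + e) z n)) (interchange x d y e)
    (pairPartition-progressions-∷ d e x y n (pairPartition-progressions d e (x + d) (y + e) n))
  where
  interchange : ∀ x d y e → (x + d) + (y + e) ≡ (x + y) + (d + e)
  interchange = ℤ-Solver.solve-∀

progression-interleave : ∀ d u m →
  progression (d + d) u (suc m) ++ progression (d + d) (u + d) m ↭ progression d u (suc (m ℕ.+ m))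
progression-interleave d u zero    = ↭-refl
progression-interleave d u (suc m) = begin
  u ∷ (progression (d + d) (u + (d + d)) (suc m) ++ (u + d) ∷ progression (d + d) ((u + d) + (d + d)) m)
    ↭⟨ prep u (shift (u + d) (progression (d + d) (u + (d + d)) (suc m)) _) ⟩
  u ∷ (u + d) ∷ (progression (d + d) (u + (d + d)) (suc m) ++ progression (d + d) ((u + d) + (d + d)) m)
    ≡⟨ cong₂ (λ v w → u ∷ (u + d) ∷ (progression (d + d) v (suc m) ++ progression (d + d) w m))
             (assoc u d) (assoc (u + d) d) ⟩
  u ∷ (u + d) ∷ (progression (d + d) w (suc m) ++ progression (d + d) (w + d) m)
    ↭⟨ prep u (prep (u + d) (progression-interleave d w m)) ⟩
  u ∷ (u + d) ∷ progression d w (suc (m ℕ.+ m))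
    ≡⟨ cong (λ n → u ∷ (u + d) ∷ progression d w n) (sym (+-suc m m)) ⟩
  progression d u (suc (suc m ℕ.+ suc m)) ∎
  where
  open PermutationReasoning
  w : ℤ
  w = (u + d) + d
  assoc : ∀ u d → u + (d + d) ≡ (u + d) + d
  assoc = ℤ-Solver.solve-∀

staircase : ∀ d x y m →
  PairPartition (progression d x (suc (m ℕ.+ m)) ++ progression d y (suc (m ℕ.+ m)))
                (progression d (x + y + d * + m) (suc (m ℕ.+ m)))
staircase d x y m =
  pairPartition-↭
    (pairPartition-++ (pairPartition-progressions d d x (y + d * + m) (suc m))
                      (pairPartition-progressions d d (x + d * + suc m) y m))
    sources sums
  where
  open PermutationReasoning
  t : ℤ
  t = x + y + d * + m
  A A′ B B′ : List ℤ
  A  = progression d x (suc m)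
  A′ = progression d (x + d * + suc m) m
  B  = progression d y m
  B′ = progression d (y + d * + m) (suc m)
  sources : (A ++ B′) ++ (A′ ++ B) ↭ progression d x (suc (m ℕ.+ m)) ++ progression d y (suc (m ℕ.+ m))
  sources = begin
    (A ++ B′) ++ (A′ ++ B) ↭⟨ ++-assoc A B′ (A′ ++ B) ⟩
    A ++ (B′ ++ (A′ ++ B)) ↭⟨ ++⁺ˡ A (++-comm B′ (A′ ++ B)) ⟩
    A ++ ((A′ ++ B) ++ B′) ↭⟨ ++⁺ˡ A (++-assoc A′ B B′) ⟩
    A ++ (A′ ++ (B ++ B′)) ↭⟨ ↭-sym (++-assoc A A′ (B ++ B′)) ⟩
    (A ++ A′) ++ (B ++ B′) ≡⟨ cong₂ _++_ (sym (progression-+ d x (suc m) m))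
                                        (trans (sym (progression-+ d y m (suc m)))
                                               (cong (progression d y) (+-suc m m))) ⟩
    progression d x (suc (m ℕ.+ m)) ++ progression d y (suc (m ℕ.+ m)) ∎
  shifted : ∀ x y d m → (x + d * (+ 1 + m)) + y ≡ (x + y + d * m) + d
  shifted = ℤ-Solver.solve-∀
  reassoc : ∀ x y d m → x + (y + d * m) ≡ x + y + d * m
  reassoc = ℤ-Solver.solve-∀
  sums : progression (d + d) (x + (y + d * + m)) (suc m) ++ progression (d + d) ((x + d * + suc m) + y) m
         ↭ progression d t (suc (m ℕ.+ m))
  sums = begin
    progression (d + d) (x + (y + d * + m)) (suc m) ++ progression (d + d) ((x + d * + suc m) + y) m
      ≡⟨ cong₂ (λ u v → progression (d + d) u (suc m) ++ progression (d + d) v m)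
               (reassoc x y d (+ m)) (shifted x y d (+ m)) ⟩
    progression (d + d) t (suc m) ++ progression (d + d) (t + d) m
      ↭⟨ progression-interleave d t m ⟩
    progression d t (suc (m ℕ.+ m)) ∎

concatMap-pairs-↭ : ∀ {A B : Set} (f g : A → B) xs →
                    concatMap (λ a → f a ∷ g a ∷ []) xs ↭ map f xs ++ map g xs
concatMap-pairs-↭ f g []       = ↭-refl
concatMap-pairs-↭ f g (a ∷ xs) =
  prep (f a) (↭-trans (prep (g a) (concatMap-pairs-↭ f g xs))
                      (↭-sym (shift (g a) (map f xs) (map g xs))))

J-progressions : ∀ p k → J p k ↭ progression (+ 3) (p + + 1) k ++ progression (+ 3) (p + + 2) k
J-progressions p k =
  ↭-trans (concatMap-pairs-↭ _ _ [1, k ])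
          (↭-reflexive (cong₂ _++_ ([1,]-progression (+ 3) (p + + 1) k λ i → first p (+ i))
                                   ([1,]-progression (+ 3) (p + + 2) k λ i → second p (+ i))))
  where
  first : ∀ p i → p + + 3 * (+ 1 + i) - + 2 ≡ (p + + 1) + + 3 * i
  first = ℤ-Solver.solve-∀
  second : ∀ p i → p + + 3 * (+ 1 + i) - + 1 ≡ (p + + 2) + + 3 * i
  second = ℤ-Solver.solve-∀

J′-progressions : ∀ p k → J′ p k ↭ progression (+ 3) (p + + 2) k ++ progression (+ 3) (p + + 4) k
J′-progressions p k =
  ↭-trans (concatMap-pairs-↭ _ _ [1, k ])
          (↭-reflexive (cong₂ _++_ ([1,]-progression (+ 3) (p + + 2) k λ i → first p (+ i))
                                   ([1,]-progression (+ 3) (p + + 4) k λ i → second p (+ i))))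
  where
  first : ∀ p i → p + + 3 * (+ 1 + i) - + 1 ≡ (p + + 2) + + 3 * i
  first = ℤ-Solver.solve-∀
  second : ∀ p i → p + + 3 * (+ 1 + i) + + 1 ≡ (p + + 4) + + 3 * i
  second = ℤ-Solver.solve-∀

n*2≡n+n : ∀ n → n ℕ.* 2 ≡ n ℕ.+ n
n*2≡n+n = ℕ-Solver.solve-∀

[n+n]/2≡n : ∀ n → (n ℕ.+ n) / 2 ≡ n
[n+n]/2≡n n = trans (cong (_/ 2) (sym (n*2≡n+n n))) (m*n/n≡m n 2)

odd-shape : ∀ {k} → k % 2 ≡ 1 → Σ ℕ λ m → k ≡ suc (m ℕ.+ m)
odd-shape {k} k%2≡1 = k / 2 , trans (m≡m%n+[m/n]*n k 2) (cong₂ ℕ._+_ k%2≡1 (n*2≡n+n (k / 2)))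

even-shape : ∀ {k} → 1 ℕ.≤ k → k % 2 ≡ 0 → Σ ℕ λ m → k ≡ suc (suc (m ℕ.+ m))
even-shape {k} 1≤k k%2≡0 =
  from-double (k / 2) (trans (m≡m%n+[m/n]*n k 2) (cong (ℕ._+ (k / 2 ℕ.* 2)) k%2≡0))
  where
  from-double : ∀ q → k ≡ q ℕ.* 2 → Σ ℕ λ m → k ≡ suc (suc (m ℕ.+ m))
  from-double zero    k≡0 with () ← subst (1 ℕ.≤_) k≡0 1≤k
  from-double (suc q) k≡q*2 = q , trans k≡q*2 (cong (λ n → suc (suc n)) (n*2≡n+n q))

+[3*[n+n]]/2≡3*n : ∀ n → + ((3 ℕ.* (n ℕ.+ n)) / 2) ≡ + 3 * + n
+[3*[n+n]]/2≡3*n n =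
  trans (cong (λ j → + (j / 2)) (*-distribˡ-+ 3 n n)) (trans (cong +_ ([n+n]/2≡n (3 ℕ.* n))) (pos-* 3 n))

OddCase : ℤ → ℕ → Set
OddCase p k =
  PairPartition (J p k) (map (λ i → + 2 * p + + ((3 ℕ.* (k ∸ 1)) / 2) + + 3 * + i) [1, k ])
  × PairPartition (J′ p k) (map (λ i → + 2 * p + + ((3 ℕ.* (k ℕ.+ 1)) / 2) + + 3 * + i) [1, k ])

EvenCase : ℤ → ℕ → Set
EvenCase p k =
  PairPartition (J p k)
    ((+ 2 * p + + 3) ∷ map (λ i → + 2 * p + + 3 * + (k / 2 ℕ.+ 1) + + 3 * + i) [1, k ∸ 1 ])
  × PairPartition (J′ p k)
    ((+ 2 * p + + 6) ∷ map (λ i → + 2 * p + + 3 * + (k / 2 ℕ.+ 2) + + 3 * + i) [1, k ∸ 1 ])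

odd-case : ∀ p m → OddCase p (suc (m ℕ.+ m))
odd-case p m =
  pairPartition-↭ (staircase (+ 3) (p + + 1) (p + + 2) m) (↭-sym (J-progressions p k))
    (↭-reflexive (progression-as-[1,] (+ 3) a k start)) ,
  pairPartition-↭ (staircase (+ 3) (p + + 2) (p + + 4) m) (↭-sym (J′-progressions p k))
    (↭-reflexive (progression-as-[1,] (+ 3) a′ k start′))
  where
  k : ℕ
  k = suc (m ℕ.+ m)
  a a′ : ℤ
  a  = + 2 * p + + ((3 ℕ.* (m ℕ.+ m)) / 2)
  a′ = + 2 * p + + ((3 ℕ.* (k ℕ.+ 1)) / 2)
  k+1≡sm+sm : ∀ m → suc (m ℕ.+ m) ℕ.+ 1 ≡ suc m ℕ.+ suc m
  k+1≡sm+sm = ℕ-Solver.solve-∀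
  sums : ∀ p m → (p + + 1) + (p + + 2) + + 3 * m ≡ + 2 * p + + 3 * m + + 3
  sums = ℤ-Solver.solve-∀
  sums′ : ∀ p m → (p + + 2) + (p + + 4) + + 3 * m ≡ + 2 * p + + 3 * (+ 1 + m) + + 3
  sums′ = ℤ-Solver.solve-∀
  start : (p + + 1) + (p + + 2) + + 3 * + m ≡ a + + 3
  start = trans (sums p (+ m)) (cong (λ c → + 2 * p + c + + 3) (sym (+[3*[n+n]]/2≡3*n m)))
  half′ : + ((3 ℕ.* (k ℕ.+ 1)) / 2) ≡ + 3 * + suc m
  half′ = trans (cong (λ j → + ((3 ℕ.* j) / 2)) (k+1≡sm+sm m)) (+[3*[n+n]]/2≡3*n (suc m))
  start′ : (p + + 2) + (p + + 4) + + 3 * + m ≡ a′ + + 3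
  start′ = trans (sums′ p (+ m)) (cong (λ c → + 2 * p + c + + 3) (sym half′))

even-case : ∀ p m → EvenCase p (suc (suc (m ℕ.+ m)))
even-case p m =
  pairPartition-↭
    (pairPartition-progressions-∷ (+ 3) (+ 3) (p + + 1) (p + + 2) n
      (staircase (+ 3) (p + + 1 + + 3) (p + + 2 + + 3) m))
    (↭-sym (J-progressions p k))
    (↭-reflexive (cong₂ _∷_ (first p) (progression-as-[1,] (+ 3) a n start))) ,
  pairPartition-↭
    (pairPartition-progressions-∷ (+ 3) (+ 3) (p + + 2) (p + + 4) n
      (staircase (+ 3) (p + + 2 + + 3) (p + + 4 + + 3) m))
    (↭-sym (J′-progressions p k))
    (↭-reflexive (cong₂ _∷_ (first′ p) (progression-as-[1,] (+ 3) a′ n start′)))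
  where
  n k : ℕ
  n = suc (m ℕ.+ m)
  k = suc n
  a a′ : ℤ
  a  = + 2 * p + + 3 * + (k / 2 ℕ.+ 1)
  a′ = + 2 * p + + 3 * + (k / 2 ℕ.+ 2)
  k/2≡sm : k / 2 ≡ suc m
  k/2≡sm = trans (cong (λ j → suc j / 2) (sym (+-suc m m))) ([n+n]/2≡n (suc m))
  first : ∀ p → (p + + 1) + (p + + 2) ≡ + 2 * p + + 3
  first = ℤ-Solver.solve-∀
  first′ : ∀ p → (p + + 2) + (p + + 4) ≡ + 2 * p + + 6
  first′ = ℤ-Solver.solve-∀
  sums : ∀ p m → (p + + 1 + + 3) + (p + + 2 + + 3) + + 3 * m ≡ + 2 * p + + 3 * ((+ 1 + m) + + 1) + + 3
  sums = ℤ-Solver.solve-∀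
  sums′ : ∀ p m → (p + + 2 + + 3) + (p + + 4 + + 3) + + 3 * m ≡ + 2 * p + + 3 * ((+ 1 + m) + + 2) + + 3
  sums′ = ℤ-Solver.solve-∀
  start : (p + + 1 + + 3) + (p + + 2 + + 3) + + 3 * + m ≡ a + + 3
  start = trans (sums p (+ m)) (cong (λ h → + 2 * p + + 3 * + (h ℕ.+ 1) + + 3) (sym k/2≡sm))
  start′ : (p + + 2 + + 3) + (p + + 4 + + 3) + + 3 * + m ≡ a′ + + 3
  start′ = trans (sums′ p (+ m)) (cong (λ h → + 2 * p + + 3 * + (h ℕ.+ 2) + + 3) (sym k/2≡sm))

lemma2p7 : (p : ℤ) → (+ 3) ∣ p → (k : ℕ) → 1 ℕ.≤ k →
    ((k % 2 ≡ 1) →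
      PairPartition (J p k)
        (map (λ i → + 2 * p + + ((3 ℕ.* (k ∸ 1)) / 2) + + 3 * + i) [1, k ])
      × PairPartition (J′ p k)
        (map (λ i → + 2 * p + + ((3 ℕ.* (k ℕ.+ 1)) / 2) + + 3 * + i) [1, k ]))
    × ((k % 2 ≡ 0) →
      PairPartition (J p k)
        ((+ 2 * p + + 3) ∷ map (λ i → + 2 * p + + 3 * + (k / 2 ℕ.+ 1) + + 3 * + i) [1, k ∸ 1 ])
      × PairPartition (J′ p k)
        ((+ 2 * p + + 6) ∷ map (λ i → + 2 * p + + 3 * + (k / 2 ℕ.+ 2) + + 3 * + i) [1, k ∸ 1 ]))
lemma2p7 p _ k 1≤k =
  (λ k%2≡1 → let m , k≡ = odd-shape k%2≡1 in subst (OddCase p) (sym k≡) (odd-case p m)) ,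
  (λ k%2≡0 → let m , k≡ = even-shape 1≤k k%2≡0 in subst (EvenCase p) (sym k≡) (even-case p m))
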